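{- If $g:\omega\to\omega$ is densely computable, then $\gamma(g)=1$.
   Context: For $A\subseteq\omega$, $\rho_n(A)=|A\cap\{0,\dots,n-1\}|/n$, $\underline{\rho}(A)=\liminf_n\rho_n(A)$, and $\rho(A)=\lim_n\rho_n(A)$ when it exists. $g$ is densely computable if there is a partial computable function $f$ with $\rho(\{n: f(n)=g(n)\})=1$. $\gamma(g)=\sup\{r:$ some total computable $f$ has $\underline{\rho}(\{n:f(n)=g(n)\})\ge r\}$. -}

module Defs where

open import Data.Nat using (ℕ; zero; suc; _<_; _≥_)
open import Data.Fin using (Fin)
open import Data.Vec using (Vec; []; _∷_; lookup)
open import Data.Maybe using (Maybe; just; nothing)
open import Data.List using (List; length)
open import Data.List.Relation.Unary.All using (All)
open import Data.List.Relation.Unary.Unique.Propositional using (Unique)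
open import Data.Product using (Σ; _×_; ∃; ∃-syntax)
open import Data.Integer using (+_)
open import Data.Rational using (ℚ; _/_; _*_; _-_; 0ℚ; 1ℚ) renaming (_≤_ to _≤ℚ_; _<_ to _<ℚ_)
open import Relation.Binary.PropositionalEquality using (_≡_)

data Code : ℕ → Set where
  zer  : ∀ {n} → Code n
  succ : Code 1
  proj : ∀ {n} → Fin n → Code n
  comp : ∀ {m n} → Code m → Vec (Code n) m → Code n
  prec : ∀ {n} → Code n → Code (suc (suc n)) → Code (suc n)
  mu   : ∀ {n} → Code (suc n) → Code n

mutual
  eval : ℕ → ∀ {n} → Code n → Vec ℕ n → Maybe ℕ
  eval zero    _          _  = nothing
  eval (suc k) zer        _  = just 0
  eval (suc k) succ (x ∷ []) = just (suc x)
  eval (suc k) (proj i)   xs = just (lookup xs i)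
  eval (suc k) (comp f gs) xs = evalComp k f (evalVec k gs xs)
  eval (suc k) (prec f g) (zero ∷ xs) = eval k f xs
  eval (suc k) (prec f g) (suc m ∷ xs) = evalPrec k g m xs (eval k (prec f g) (m ∷ xs))
  eval (suc k) (mu f)     xs = evalMu k f xs 0

  evalVec : ℕ → ∀ {m n} → Vec (Code n) m → Vec ℕ n → Maybe (Vec ℕ m)
  evalVec k []       xs = just []
  evalVec k (g ∷ gs) xs = cons (eval k g xs) (evalVec k gs xs)

  evalComp : ℕ → ∀ {m} → Code m → Maybe (Vec ℕ m) → Maybe ℕ
  evalComp k f nothing   = nothing
  evalComp k f (just ys) = eval k f ys

  evalPrec : ℕ → ∀ {n} → Code (suc (suc n)) → ℕ → Vec ℕ n → Maybe ℕ → Maybe ℕ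
  evalPrec k g m xs nothing  = nothing
  evalPrec k g m xs (just r) = eval k g (m ∷ r ∷ xs)

  evalMu : ℕ → ∀ {n} → Code (suc n) → Vec ℕ n → ℕ → Maybe ℕ
  evalMu zero    f xs x = nothing
  evalMu (suc k) f xs x = muStep k f xs x (eval k f (x ∷ xs))

  muStep : ℕ → ∀ {n} → Code (suc n) → Vec ℕ n → ℕ → Maybe ℕ → Maybe ℕ
  muStep k f xs x nothing        = nothing
  muStep k f xs x (just zero)    = just x
  muStep k f xs x (just (suc _)) = evalMu k f xs (suc x)

  cons : ∀ {m} → Maybe ℕ → Maybe (Vec ℕ m) → Maybe (Vec ℕ (suc m))
  cons (just y) (just ys) = just (y ∷ ys)
  cons _        _         = nothing

_⟦_⟧≡_ : Code 1 → ℕ → ℕ → Set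
c ⟦ n ⟧≡ y = ∃[ fuel ] eval fuel c (n ∷ []) ≡ just y

Computable : (ℕ → ℕ) → Set
Computable f = Σ (Code 1) λ c → ∀ n → c ⟦ n ⟧≡ f n

-- Densities (only lower bounds are needed; sets are predicates on ℕ).

ℕ→ℚ : ℕ → ℚ
ℕ→ℚ n = + n / 1

AtLeast : (ℕ → Set) → ℕ → ℕ → Set
AtLeast A k n = Σ (List ℕ) λ xs → Unique xs × All (λ x → x < n × A x) xs × length xs ≡ k

-- liminf_n ρ_n(A) ≥ r
LowerDensity≥ : (ℕ → Set) → ℚ → Set
LowerDensity≥ A r =
  ∀ (ε : ℚ) → 0ℚ <ℚ ε → ∃[ N ] ∀ n → n ≥ N →
    ∃[ k ] (AtLeast A k n × (r - ε) * ℕ→ℚ n ≤ℚ ℕ→ℚ k)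

-- ρ(A) = 1  (equivalent to liminf ρ_n(A) ≥ 1, since ρ_n(A) ≤ 1 always)
DensityOne : (ℕ → Set) → Set
DensityOne A = LowerDensity≥ A 1ℚ

DenselyComputable : (ℕ → ℕ) → Set
DenselyComputable g = Σ (Code 1) λ c → DensityOne (λ n → c ⟦ n ⟧≡ g n)

-- γ(g) = 1 : since every ρ_n ≤ 1, γ(g) ≤ 1 always; γ(g) = 1 iff every rational
-- r < 1 is attained as a lower bound for some total computable f.
GammaOne : (ℕ → ℕ) → Set
GammaOne g = ∀ (r : ℚ) → r <ℚ 1ℚ →
  Σ (ℕ → ℕ) λ f → Computable f × LowerDensity≥ (λ n → f n ≡ g n) r

module Submission where

-- Let the code c compute g on a set of density one. Cut ℕ into the blocks [b, 2b), b = B₀·2ᵏ. Since c agrees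
-- with g on almost all of [0, 2b), by some stage S it has halted on all but b/M points of [b, 2b); a total search
-- finds such a stage, and f outputs on the block what c has output by that stage. On the block f then differs
-- from g only where c has not halted or is wrong, on at most 2b/M points. The step-bounded evaluator is itself
-- total computable, hence so is f. Summing the errors over the geometrically growing blocks, f agrees with g on
-- all but B₀ + 4n/M of the first n numbers, which for M = 8q beats any r = p/q < 1.

open import Defs
open import Data.Nat
open import Data.Nat.Properties
open import Data.Nat.Tactic.RingSolver using (solve-∀)
open import Data.Nat.Coprimality using (Coprime; coprime-+; 1-coprimeTo) renaming (sym to coprime-sym)
open import Data.Integer as ℤ using (+_; -[1+_])
import Data.Integer.Properties as ℤ
open import Data.Rational as ℚ using (ℚ; mkℚ; *<*; 0ℚ; 1ℚ; ↥_; ↧_; ↧ₙ_; toℚᵘ)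
import Data.Rational.Properties as ℚ
import Data.Rational.Unnormalised as ℚᵘ
import Data.Rational.Unnormalised.Properties as ℚᵘ
open import Data.Fin using (Fin; zero; suc)
open import Data.Vec using (Vec; []; _∷_; lookup; head; tail; tabulate)
open import Data.Vec.Properties using (tabulate∘lookup)
open import Data.Maybe using (Maybe; just; nothing)
open import Data.Maybe.Properties using (just-injective)
open import Data.List using (List; []; _∷_; length; filter; downFrom)
open import Data.List.Properties using (filter-all; filter-accept; filter-reject)
open import Data.List.Relation.Unary.All as All using (All; []; _∷_)
import Data.List.Relation.Unary.All.Properties as All
open import Data.List.Relation.Unary.AllPairs using ([]; _∷_)
open import Data.List.Relation.Unary.Unique.Propositional using (Unique)
import Data.List.Relation.Unary.Unique.Propositional.Properties as Unique
open import Data.List.Membership.Propositional.Properties using (∈-downFrom⁻)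
open import Data.Product using (Σ; _×_; ∃-syntax; _,_; proj₁; proj₂)
open import Data.Sum using (_⊎_; inj₁; inj₂)
open import Data.Empty using (⊥-elim)
open import Function using (_∘′_)
open import Relation.Binary.PropositionalEquality
open import Relation.Nullary using (¬_; Dec; yes; no; ¬?; contradiction)
open import Relation.Unary using (Decidable)
open import Algebra.Properties.CommutativeSemigroup +-commutativeSemigroup using (xy∙z≈xz∙y) renaming (interchange to +-interchange)
open import Algebra.Properties.AbelianGroup ℚ.+-0-abelianGroup using (⁻¹-anti-homo‿-; xyx⁻¹≈y)

-- Fuel and total computable functions

upward-closed : {P : ℕ → Set} → (∀ {k} → P k → P (suc k)) → ∀ {k k′} → k ≤ k′ → P k → P k′
upward-closed {P} step k≤k′ = go (≤⇒≤′ k≤k′)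
  where
  go : ∀ {k k′} → k ≤′ k′ → P k → P k′
  go ≤′-refl       p = p
  go (≤′-step k≤k′) p = step (go k≤k′ p)

mutual
  eval-suc : ∀ k {n} (c : Code n) xs {y} → eval k c xs ≡ just y → eval (suc k) c xs ≡ just y
  eval-suc (suc k) zer        xs       h = h
  eval-suc (suc k) succ       (x ∷ []) h = h
  eval-suc (suc k) (proj i)   xs       h = h
  eval-suc (suc k) (comp f gs) xs h with evalVec k gs xs in eq
  ... | just ys rewrite evalVec-suc k gs xs eq = eval-suc k f ys h
  eval-suc (suc k) (prec f g) (zero ∷ xs)  h = eval-suc k f xs h
  eval-suc (suc k) (prec f g) (suc m ∷ xs) h with eval k (prec f g) (m ∷ xs) in eq
  ... | just r rewrite eval-suc k (prec f g) (m ∷ xs) eq = eval-suc k g (m ∷ r ∷ xs) h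
  eval-suc (suc k) (mu f)     xs h = evalMu-suc k f xs 0 h

  evalVec-suc : ∀ k {m n} (gs : Vec (Code n) m) xs {ys} →
                evalVec k gs xs ≡ just ys → evalVec (suc k) gs xs ≡ just ys
  evalVec-suc k []       xs h = h
  evalVec-suc k (g ∷ gs) xs h with eval k g xs in e₁ | evalVec k gs xs in e₂
  ... | just y | just ys rewrite eval-suc k g xs e₁ | evalVec-suc k gs xs e₂ = h

  evalMu-suc : ∀ k {n} (f : Code (suc n)) xs x {y} →
               evalMu k f xs x ≡ just y → evalMu (suc k) f xs x ≡ just y
  evalMu-suc (suc k) f xs x h with eval k f (x ∷ xs) in eq
  ... | just zero    rewrite eval-suc k f (x ∷ xs) eq = h
  ... | just (suc _) rewrite eval-suc k f (x ∷ xs) eq = evalMu-suc k f xs (suc x) h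

eval-mono : ∀ {k k′ n} (c : Code n) xs {y} → k ≤ k′ → eval k c xs ≡ just y → eval k′ c xs ≡ just y
eval-mono c xs {y} = upward-closed {λ k → eval k c xs ≡ just y} (λ {k} → eval-suc k c xs)

evalVec-mono : ∀ {k k′ m n} (gs : Vec (Code n) m) xs {ys} →
               k ≤ k′ → evalVec k gs xs ≡ just ys → evalVec k′ gs xs ≡ just ys
evalVec-mono gs xs {ys} = upward-closed {λ k → evalVec k gs xs ≡ just ys} (λ {k} → evalVec-suc k gs xs)

evalMu-mono : ∀ {k k′ n} (f : Code (suc n)) xs x {y} →
              k ≤ k′ → evalMu k f xs x ≡ just y → evalMu k′ f xs x ≡ just y
evalMu-mono f xs x {y} = upward-closed {λ k → evalMu k f xs x ≡ just y} (λ {k} → evalMu-suc k f xs x)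

Computableₙ : ∀ n → (Vec ℕ n → ℕ) → Set
Computableₙ n F = Σ (Code n) λ c → ∀ xs → ∃[ k ] eval k c xs ≡ just (F xs)

ComputableVec : ∀ n m → (Vec ℕ n → Vec ℕ m) → Set
ComputableVec n m G = Σ (Vec (Code n) m) λ gs → ∀ xs → ∃[ k ] evalVec k gs xs ≡ just (G xs)

computable-cong : ∀ {n F G} → Computableₙ n F → (∀ xs → F xs ≡ G xs) → Computableₙ n G
computable-cong (c , c⇓) F≗G = c , λ xs → proj₁ (c⇓ xs) , trans (proj₂ (c⇓ xs)) (cong just (F≗G xs))

computableVec-cong : ∀ {n m F G} → ComputableVec n m F → (∀ xs → F xs ≡ G xs) → ComputableVec n m G
computableVec-cong (gs , gs⇓) F≗G = gs , λ xs → proj₁ (gs⇓ xs) , trans (proj₂ (gs⇓ xs)) (cong just (F≗G xs))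

zero-computable : ∀ {n} → Computableₙ n (λ _ → 0)
zero-computable = zer , λ _ → 1 , refl

suc-computable : Computableₙ 1 (λ xs → suc (head xs))
suc-computable = succ , λ { (x ∷ []) → 1 , refl }

proj-computable : ∀ {n} (i : Fin n) → Computableₙ n (λ xs → lookup xs i)
proj-computable i = proj i , λ _ → 1 , refl

[]-computable : ∀ {n} → ComputableVec n 0 (λ _ → [])
[]-computable = [] , λ _ → 0 , refl

∷-computable : ∀ {n m F G} → Computableₙ n F → ComputableVec n m G →
               ComputableVec n (suc m) (λ xs → F xs ∷ G xs)
∷-computable (c , c⇓) (gs , gs⇓) = c ∷ gs , λ xs →
  let (k₁ , e₁) = c⇓ xs ; (k₂ , e₂) = gs⇓ xs in
  k₁ ⊔ k₂ , cong₂ cons (eval-mono c xs (m≤m⊔n k₁ k₂) e₁) (evalVec-mono gs xs (m≤n⊔m k₁ k₂) e₂)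

∘-computable : ∀ {n m F G} → Computableₙ m F → ComputableVec n m G → Computableₙ n (λ xs → F (G xs))
∘-computable {G = G} (f , f⇓) (gs , gs⇓) = comp f gs , λ xs →
  let (k₁ , e₁) = gs⇓ xs ; (k₂ , e₂) = f⇓ (G xs) in
  suc (k₁ ⊔ k₂) , trans (cong (evalComp (k₁ ⊔ k₂) f) (evalVec-mono gs xs (m≤m⊔n k₁ k₂) e₁))
                        (eval-mono f (G xs) (m≤n⊔m k₁ k₂) e₂)

primRec : ∀ {n} → (Vec ℕ n → ℕ) → (Vec ℕ (suc (suc n)) → ℕ) → Vec ℕ (suc n) → ℕ
primRec F G (zero  ∷ xs) = F xs
primRec F G (suc m ∷ xs) = G (m ∷ primRec F G (m ∷ xs) ∷ xs)

primRec-computable : ∀ {n F G} → Computableₙ n F → Computableₙ (suc (suc n)) G →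
                     Computableₙ (suc n) (primRec F G)
primRec-computable {F = F} {G} (f , f⇓) (g , g⇓) = prec f g , go
  where
  go : ∀ xs → ∃[ k ] eval k (prec f g) xs ≡ just (primRec F G xs)
  go (zero ∷ xs) = let (k , e) = f⇓ xs in suc k , e
  go (suc m ∷ xs) =
    let (k₁ , e₁) = go (m ∷ xs) ; (k₂ , e₂) = g⇓ (m ∷ primRec F G (m ∷ xs) ∷ xs) in
    suc (k₁ ⊔ k₂) , trans (cong (evalPrec (k₁ ⊔ k₂) g m xs) (eval-mono (prec f g) (m ∷ xs) (m≤m⊔n k₁ k₂) e₁))
                          (eval-mono g _ (m≤n⊔m k₁ k₂) e₂)

module _ {n} {F : Vec ℕ (suc n) → ℕ} (F-computable : Computableₙ (suc n) F) where
  private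
    f : Code (suc n)
    f = proj₁ F-computable
    f⇓ : ∀ xs → ∃[ k ] eval k f xs ≡ just (F xs)
    f⇓ = proj₂ F-computable

  evalMu-finds-zero : ∀ xs d x → F (x + d ∷ xs) ≡ 0 →
                      Σ ℕ λ z → F (z ∷ xs) ≡ 0 × ∃[ k ] evalMu k f xs x ≡ just z
  evalMu-finds-zero xs d x Fx+d≡0 with f⇓ (x ∷ xs) | F (x ∷ xs) in Fx≡
  ... | k , e | zero = x , Fx≡ , suc k , cong (muStep k f xs x) (trans e (cong just Fx≡))
  evalMu-finds-zero xs zero x Fx≡0 | k , e | suc _
    rewrite +-identityʳ x with () ← trans (sym Fx≡) Fx≡0
  evalMu-finds-zero xs (suc d) x Fx+d≡0 | k , e | suc _
    with z , Fz≡0 , K , eK ← evalMu-finds-zero xs d (suc x) (subst (λ u → F (u ∷ xs) ≡ 0) (+-suc x d) Fx+d≡0)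
    = z , Fz≡0 , suc (k ⊔ K) ,
      trans (cong (muStep (k ⊔ K) f xs x) (eval-mono f (x ∷ xs) (m≤m⊔n k K) (trans e (cong just Fx≡))))
            (evalMu-mono f xs (suc x) (m≤n⊔m k K) eK)

  μ-computable : (∀ xs → ∃[ x ] F (x ∷ xs) ≡ 0) →
                 Σ (Vec ℕ n → ℕ) λ G → Computableₙ n G × (∀ xs → F (G xs ∷ xs) ≡ 0)
  μ-computable root = (λ xs → proj₁ (search xs)) , (mu f , λ xs → let (_ , _ , k , e) = search xs in suc k , e)
                    , (λ xs → proj₁ (proj₂ (search xs)))
    where
    search : ∀ xs → Σ ℕ λ z → F (z ∷ xs) ≡ 0 × ∃[ k ] evalMu k f xs 0 ≡ just z
    search xs = evalMu-finds-zero xs (proj₁ (root xs)) 0 (proj₂ (root xs))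

pointwise₁ : ∀ {n} {h : ℕ → ℕ} {A} → Computableₙ 1 (λ v → h (head v)) →
             Computableₙ n A → Computableₙ n (λ xs → h (A xs))
pointwise₁ h a = ∘-computable h (∷-computable a []-computable)

pointwise₂ : ∀ {n} {h : ℕ → ℕ → ℕ} {A B} → Computableₙ 2 (λ v → h (lookup v zero) (lookup v (suc zero))) →
             Computableₙ n A → Computableₙ n B → Computableₙ n (λ xs → h (A xs) (B xs))
pointwise₂ h a b = ∘-computable h (∷-computable a (∷-computable b []-computable))

pointwise₃ : ∀ {n} {h : ℕ → ℕ → ℕ → ℕ} {A B C} →
             Computableₙ 3 (λ v → h (lookup v zero) (lookup v (suc zero)) (lookup v (suc (suc zero)))) →
             Computableₙ n A → Computableₙ n B → Computableₙ n C → Computableₙ n (λ xs → h (A xs) (B xs) (C xs))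
pointwise₃ h a b c = ∘-computable h (∷-computable a (∷-computable b (∷-computable c []-computable)))

suc∘-computable : ∀ {n A} → Computableₙ n A → Computableₙ n (λ xs → suc (A xs))
suc∘-computable = pointwise₁ {h = suc} suc-computable

const-computable : ∀ {n} c → Computableₙ n (λ _ → c)
const-computable zero    = zero-computable
const-computable (suc c) = suc∘-computable (const-computable c)

+-computable : ∀ {n A B} → Computableₙ n A → Computableₙ n B → Computableₙ n (λ xs → A xs + B xs)
+-computable = pointwise₂ {h = _+_} (computable-cong (primRec-computable (proj-computable zero)
                                                       (suc∘-computable (proj-computable (suc zero))))
                                                     λ { (a ∷ b ∷ []) → primRec-+ a b })
  where
  primRec-+ : ∀ a b → primRec (λ xs → lookup xs zero) (λ xs → suc (lookup xs (suc zero))) (a ∷ b ∷ []) ≡ a + b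
  primRec-+ zero    b = refl
  primRec-+ (suc a) b = cong suc (primRec-+ a b)

*-computable : ∀ {n A} c → Computableₙ n A → Computableₙ n (λ xs → c * A xs)
*-computable zero    a = zero-computable
*-computable (suc c) a = +-computable a (*-computable c a)

pred-computable : ∀ {n A} → Computableₙ n A → Computableₙ n (λ xs → pred (A xs))
pred-computable = pointwise₁ {h = pred} (computable-cong (primRec-computable zero-computable (proj-computable zero))
                                                         λ { (zero ∷ []) → refl ; (suc a ∷ []) → refl })

∸-computable : ∀ {n A B} → Computableₙ n A → Computableₙ n B → Computableₙ n (λ xs → A xs ∸ B xs)
∸-computable a b = ∘-computable flipped-∸ (∷-computable b (∷-computable a []-computable))
  where
  primRec-∸ : ∀ b a → primRec (λ xs → lookup xs zero) (λ xs → pred (lookup xs (suc zero))) (b ∷ a ∷ []) ≡ a ∸ b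
  primRec-∸ zero    a = refl
  primRec-∸ (suc b) a = trans (cong pred (primRec-∸ b a)) (pred[m∸n]≡m∸[1+n] a b)
  flipped-∸ : Computableₙ 2 (λ v → lookup v (suc zero) ∸ lookup v zero)
  flipped-∸ = computable-cong (primRec-computable (proj-computable zero) (pred-computable (proj-computable (suc zero))))
                              λ { (b ∷ a ∷ []) → primRec-∸ b a }

ifz : ℕ → ℕ → ℕ → ℕ
ifz zero    a b = a
ifz (suc _) a b = b

ifz-computable : ∀ {n A B C} → Computableₙ n A → Computableₙ n B → Computableₙ n C →
                 Computableₙ n (λ xs → ifz (A xs) (B xs) (C xs))
ifz-computable = pointwise₃ {h = ifz} (computable-cong (primRec-computable (proj-computable zero)
                                                                           (proj-computable (suc (suc (suc zero)))))
                                        λ { (zero ∷ a ∷ b ∷ []) → refl ; (suc _ ∷ a ∷ b ∷ []) → refl })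

-- The step-bounded evaluator is computable

encode : Maybe ℕ → ℕ
encode nothing  = 0
encode (just y) = suc y

select-computable : ∀ {n m} (ρ : Fin m → Fin n) → ComputableVec n m (λ xs → tabulate (λ i → lookup xs (ρ i)))
select-computable {m = zero}  ρ = []-computable
select-computable {m = suc m} ρ = ∷-computable (proj-computable (ρ zero)) (select-computable (λ i → ρ (suc i)))

drop₂-computable : ∀ {n} → ComputableVec (2 + n) n (λ v → tail (tail v))
drop₂-computable = computableVec-cong (select-computable (λ i → suc (suc i)))
                                      λ { (_ ∷ _ ∷ xs) → tabulate∘lookup xs }

drop₃-computable : ∀ {n} → ComputableVec (3 + n) n (λ v → tail (tail (tail v)))
drop₃-computable = computableVec-cong (select-computable (λ i → suc (suc (suc i))))
                                      λ { (_ ∷ _ ∷ _ ∷ xs) → tabulate∘lookup xs }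

isJustᵛ : ∀ {m} → Maybe (Vec ℕ m) → ℕ
isJustᵛ nothing  = 0
isJustᵛ (just _) = 1

isJustᵛ-cons : ∀ {m} (a : Maybe ℕ) (b : Maybe (Vec ℕ m)) → ifz (encode a) 0 (isJustᵛ b) ≡ isJustᵛ (cons a b)
isJustᵛ-cons nothing  b        = refl
isJustᵛ-cons (just y) nothing  = refl
isJustᵛ-cons (just y) (just _) = refl

evalVecValues : ∀ {n m} → ℕ → Vec (Code n) m → Vec ℕ n → Vec ℕ m
evalVecValues k []       xs = []
evalVecValues k (g ∷ gs) xs = pred (encode (eval k g xs)) ∷ evalVecValues k gs xs

evalVecValues-just : ∀ {n m} k (gs : Vec (Code n) m) xs {ys} →
                     evalVec k gs xs ≡ just ys → evalVecValues k gs xs ≡ ys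
evalVecValues-just k []       xs refl = refl
evalVecValues-just k (g ∷ gs) xs h with eval k g xs | evalVec k gs xs in e
evalVecValues-just k (g ∷ gs) xs refl | just y | just ys = cong (y ∷_) (evalVecValues-just k gs xs e)

evalComp-encode : ∀ {n m} k (f : Code m) (gs : Vec (Code n) m) xs →
  ifz (isJustᵛ (evalVec k gs xs)) 0 (encode (eval k f (evalVecValues k gs xs))) ≡ encode (evalComp k f (evalVec k gs xs))
evalComp-encode k f gs xs with evalVec k gs xs in e
... | nothing = refl
... | just ys rewrite evalVecValues-just k gs xs e = refl

eval-prec-out-of-fuel : ∀ {n} (f : Code n) g k m xs → k ≤ m → eval k (prec f g) (m ∷ xs) ≡ nothing
eval-prec-out-of-fuel f g zero    m       xs _         = refl
eval-prec-out-of-fuel f g (suc k) (suc m) xs (s≤s k≤m) rewrite eval-prec-out-of-fuel f g k m xs k≤m = refl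

evalPrecStep : ∀ {n} → Code (2 + n) → Vec ℕ (3 + n) → ℕ
evalPrecStep g (m ∷ t ∷ K ∷ xs) = ifz t 0 (encode (eval (suc (m + K)) g (m ∷ pred t ∷ xs)))

-- With K steps of fuel to spare, evaluating prec f g on m consumes one step per recursive call,
-- so its encoded value is a primitive recursion on m.
eval-prec-by-primRec : ∀ {n} (f : Code n) g m K xs →
  primRec (λ v → encode (eval (head v) f (tail v))) (evalPrecStep g) (m ∷ K ∷ xs)
  ≡ encode (eval (suc (m + K)) (prec f g) (m ∷ xs))
eval-prec-by-primRec f g zero    K xs = refl
eval-prec-by-primRec f g (suc m) K xs rewrite eval-prec-by-primRec f g m K xs
  with eval (suc (m + K)) (prec f g) (m ∷ xs)
... | nothing = refl
... | just _  = refl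

evalMuStep : ∀ {n} → Code (suc n) → Vec ℕ (3 + n) → ℕ
evalMuStep f (j ∷ w ∷ k ∷ xs) =
  ifz (encode (eval j f (k ∸ suc j ∷ xs))) 0 (ifz (pred (encode (eval j f (k ∸ suc j ∷ xs)))) (suc (k ∸ suc j)) w)

-- evalMu j f xs (k ∸ j) starts its search one step earlier for each extra unit of fuel j,
-- so for fixed k it is a primitive recursion on j; the case j = k is the search from 0.
evalMu-by-primRec : ∀ {n} (f : Code (suc n)) j k xs → j ≤ k →
  primRec (λ _ → 0) (evalMuStep f) (j ∷ k ∷ xs) ≡ encode (evalMu j f xs (k ∸ j))
evalMu-by-primRec f zero    k       xs _ = refl
evalMu-by-primRec f (suc j) (suc k) xs (s≤s j≤k)
  rewrite evalMu-by-primRec f j (suc k) xs (m≤n⇒m≤1+n j≤k) | +-∸-assoc 1 j≤k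
  with eval j f ((k ∸ j) ∷ xs)
... | nothing      = refl
... | just zero    = refl
... | just (suc _) = refl

eval-suc-prec : ∀ {n} (f : Code n) g k m xs →
  ifz (m ∸ k) (encode (eval (suc (m + (k ∸ m))) (prec f g) (m ∷ xs))) 0 ≡ encode (eval (suc k) (prec f g) (m ∷ xs))
eval-suc-prec f g k m xs with m ∸ k in m∸k≡
... | zero  = cong (λ z → encode (eval (suc z) (prec f g) (m ∷ xs))) (m+[n∸m]≡n (m∸n≡0⇒m≤n m∸k≡))
... | suc _ = cong encode (sym (eval-prec-out-of-fuel f g (suc k) m xs k<m))
  where
  k<m : k < m
  k<m = ≰⇒> λ m≤k → 1+n≢0 (trans (sym m∸k≡) (m≤n⇒m∸n≡0 m≤k))

-- The ignored second argument lets eval-suc-computable serve as the step function of a primitive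
-- recursion on the fuel.
mutual
  eval-computable : ∀ {n} (c : Code n) → Computableₙ (suc n) (λ v → encode (eval (head v) c (tail v)))
  eval-computable c = computable-cong (primRec-computable zero-computable (eval-suc-computable c))
                                      λ { (zero ∷ xs) → refl ; (suc k ∷ xs) → refl }

  eval-skip-computable : ∀ {n} (c : Code n) → Computableₙ (2 + n) (λ v → encode (eval (head v) c (tail (tail v))))
  eval-skip-computable c = computable-cong (∘-computable (eval-computable c) (∷-computable (proj-computable zero) drop₂-computable))
                                            λ { (_ ∷ _ ∷ _) → refl }

  isJustᵛ-computable : ∀ {n m} (gs : Vec (Code n) m) →
                       Computableₙ (2 + n) (λ v → isJustᵛ (evalVec (head v) gs (tail (tail v))))
  isJustᵛ-computable []       = const-computable 1
  isJustᵛ-computable (g ∷ gs) = computable-cong (ifz-computable (eval-skip-computable g) zero-computable (isJustᵛ-computable gs))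
                                               λ { (k ∷ _ ∷ xs) → isJustᵛ-cons (eval k g xs) (evalVec k gs xs) }

  evalVecValues-computable : ∀ {n m} (gs : Vec (Code n) m) →
                             ComputableVec (2 + n) m (λ v → evalVecValues (head v) gs (tail (tail v)))
  evalVecValues-computable []       = []-computable
  evalVecValues-computable (g ∷ gs) = ∷-computable (pred-computable (eval-skip-computable g)) (evalVecValues-computable gs)

  eval-suc-computable : ∀ {n} (c : Code n) → Computableₙ (2 + n) (λ v → encode (eval (suc (head v)) c (tail (tail v))))
  eval-suc-computable zer      = computable-cong (const-computable 1) λ { (_ ∷ _ ∷ _) → refl }
  eval-suc-computable succ     = computable-cong (suc∘-computable (suc∘-computable (proj-computable (suc (suc zero)))))
                                                 λ { (_ ∷ _ ∷ x ∷ []) → refl }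
  eval-suc-computable (proj i) = computable-cong (suc∘-computable (proj-computable (suc (suc i)))) λ { (_ ∷ _ ∷ _) → refl }
  eval-suc-computable (comp f gs) =
    computable-cong (ifz-computable (isJustᵛ-computable gs) zero-computable
                                    (∘-computable (eval-computable f)
                                                  (∷-computable (proj-computable zero) (evalVecValues-computable gs))))
                    λ { (k ∷ _ ∷ xs) → evalComp-encode k f gs xs }
  eval-suc-computable {suc n} (prec f g) =
    computable-cong (ifz-computable (∸-computable m k)
                                    (∘-computable by-primRec (∷-computable m (∷-computable (∸-computable k m) drop₃-computable)))
                                    zero-computable)
                    λ { (k ∷ _ ∷ m ∷ xs) → eval-suc-prec f g k m xs }
    where
    k : Computableₙ (3 + n) (λ v → lookup v zero)
    k = proj-computable zero
    m : Computableₙ (3 + n) (λ v → lookup v (suc (suc zero)))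
    m = proj-computable (suc (suc zero))
    by-primRec : Computableₙ (2 + n) (λ v → encode (eval (suc (head v + lookup v (suc zero))) (prec f g) (head v ∷ tail (tail v))))
    by-primRec = computable-cong (primRec-computable (eval-computable f) (evalPrecStep-computable g))
                                 λ { (m ∷ K ∷ xs) → eval-prec-by-primRec f g m K xs }
  eval-suc-computable {n} (mu f) =
    computable-cong (∘-computable (primRec-computable zero-computable (evalMuStep-computable f))
                                  (∷-computable k (∷-computable k drop₂-computable)))
      λ { (k ∷ _ ∷ xs) → trans (evalMu-by-primRec f k k xs ≤-refl) (cong (λ z → encode (evalMu k f xs z)) (n∸n≡0 k)) }
    where
    k : Computableₙ (2 + n) (λ v → lookup v zero)
    k = proj-computable zero

  evalPrecStep-computable : ∀ {n} (g : Code (2 + n)) → Computableₙ (3 + n) (evalPrecStep g)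
  evalPrecStep-computable g = computable-cong
    (ifz-computable (proj-computable (suc zero)) zero-computable
      (∘-computable (eval-computable g)
        (∷-computable (suc∘-computable (+-computable (proj-computable zero) (proj-computable (suc (suc zero)))))
          (∷-computable (proj-computable zero) (∷-computable (pred-computable (proj-computable (suc zero))) drop₃-computable)))))
    λ { (_ ∷ _ ∷ _ ∷ _) → refl }

  evalMuStep-computable : ∀ {n} (f : Code (suc n)) → Computableₙ (3 + n) (evalMuStep f)
  evalMuStep-computable {n} f = computable-cong
    (ifz-computable test zero-computable (ifz-computable (pred-computable test) (suc∘-computable start) (proj-computable (suc zero))))
    λ { (_ ∷ _ ∷ _ ∷ _) → refl }
    where
    start : Computableₙ (3 + n) (λ v → lookup v (suc (suc zero)) ∸ suc (lookup v zero))
    start = ∸-computable (proj-computable (suc (suc zero))) (suc∘-computable (proj-computable zero))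
    test : Computableₙ (3 + n) (λ v → encode (eval (lookup v zero) f
                                            ((lookup v (suc (suc zero)) ∸ suc (lookup v zero)) ∷ tail (tail (tail v)))))
    test = ∘-computable (eval-computable f) (∷-computable (proj-computable zero) (∷-computable start drop₃-computable))

-- Counting

length≤1+length-filter-≢ : ∀ z {L : List ℕ} → Unique L → length L ≤ suc (length (filter (λ x → ¬? (x ≟ z)) L))
length≤1+length-filter-≢ z {[]}    []       = z≤n
length≤1+length-filter-≢ z {x ∷ L} (x∉L ∷ L!) with x ≟ z
... | yes refl = s≤s (≤-reflexive (sym (trans (cong length (filter-reject ≢z? λ z≢z → z≢z refl))
                                              (cong length (filter-all ≢z? (All.map ≢-sym x∉L))))))
  where
  ≢z? : Decidable (λ x → ¬ x ≡ z)
  ≢z? x = ¬? (x ≟ z)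
... | no x≢z   = s≤s (≤-trans (length≤1+length-filter-≢ z L!)
                              (≤-reflexive (cong length (sym (filter-accept (λ x → ¬? (x ≟ z)) x≢z)))))

length-filter-partition : ∀ {P : ℕ → Set} (P? : Decidable P) L →
                          length (filter P? L) + length (filter (λ x → ¬? (P? x)) L) ≡ length L
length-filter-partition P? []      = refl
length-filter-partition P? (x ∷ L) with P? x
... | yes _ = cong suc (length-filter-partition P? L)
... | no  _ = trans (+-suc _ _) (cong suc (length-filter-partition P? L))

sumFrom : (ℕ → ℕ) → ℕ → ℕ → ℕ
sumFrom h lo zero    = 0
sumFrom h lo (suc i) = sumFrom h lo i + h (lo + i)

sumFrom-+ : ∀ h lo i j → sumFrom h lo (i + j) ≡ sumFrom h lo i + sumFrom h (lo + i) j
sumFrom-+ h lo i zero    rewrite +-identityʳ i = sym (+-identityʳ _)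
sumFrom-+ h lo i (suc j) rewrite +-suc i j | sumFrom-+ h lo i j | +-assoc lo i j = +-assoc (sumFrom h lo i) _ _

sumFrom-cong : ∀ {h h′} lo i → (∀ x → lo ≤ x → x < lo + i → h x ≡ h′ x) → sumFrom h lo i ≡ sumFrom h′ lo i
sumFrom-cong lo zero    _   = refl
sumFrom-cong lo (suc i) h≗h′ =
  cong₂ _+_ (sumFrom-cong lo i λ x lo≤x x<lo+i → h≗h′ x lo≤x (≤-trans x<lo+i (+-monoʳ-≤ lo (n≤1+n i))))
            (h≗h′ (lo + i) (m≤m+n lo i) (subst (lo + i <_) (sym (+-suc lo i)) ≤-refl))

sumFrom-≤ : ∀ {h} → (∀ x → h x ≤ 1) → ∀ lo i → sumFrom h lo i ≤ i
sumFrom-≤     h≤1 lo zero    = z≤n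
sumFrom-≤ {h} h≤1 lo (suc i) = subst (sumFrom h lo (suc i) ≤_) (+-comm i 1) (+-mono-≤ (sumFrom-≤ h≤1 lo i) (h≤1 (lo + i)))

sumFrom-complement : ∀ {h} → (∀ x → h x ≤ 1) → ∀ lo i → sumFrom h lo i + sumFrom (λ x → 1 ∸ h x) lo i ≡ i
sumFrom-complement         h≤1 lo zero    = refl
sumFrom-complement {h = h} h≤1 lo (suc i) = begin
  (A + h z) + (B + (1 ∸ h z)) ≡⟨ +-interchange A (h z) B (1 ∸ h z) ⟩
  (A + B) + (h z + (1 ∸ h z)) ≡⟨ cong₂ _+_ (sumFrom-complement h≤1 lo i) (m+[n∸m]≡n (h≤1 z)) ⟩
  i + 1                       ≡⟨ +-comm i 1 ⟩
  suc i                       ∎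
  where
  open ≡-Reasoning
  z A B : ℕ
  z = lo + i
  A = sumFrom h lo i
  B = sumFrom (λ x → 1 ∸ h x) lo i

sumFrom-computable : ∀ {n} {H : Vec ℕ n → ℕ → ℕ} → Computableₙ (suc n) (λ v → H (tail v) (head v)) →
                     Computableₙ (2 + n) (λ v → sumFrom (H (tail (tail v))) (lookup v (suc zero)) (lookup v zero))
sumFrom-computable {n} {H} h = computable-cong
  (primRec-computable zero-computable
    (+-computable (proj-computable (suc zero))
                  (∘-computable h (∷-computable (+-computable (proj-computable (suc (suc zero))) (proj-computable zero))
                                                drop₃-computable))))
  λ { (i ∷ lo ∷ ps) → sumFrom-by-primRec i lo ps }
  where
  sumFrom-by-primRec : ∀ i lo ps →
    primRec (λ _ → 0) (λ v → lookup v (suc zero) + H (tail (tail (tail v))) (lookup v (suc (suc zero)) + lookup v zero))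
            (i ∷ lo ∷ ps)
    ≡ sumFrom (H ps) lo i
  sumFrom-by-primRec zero    lo ps = refl
  sumFrom-by-primRec (suc i) lo ps = cong (_+ H ps (lo + i)) (sumFrom-by-primRec i lo ps)

InInterval : ℕ → ℕ → ℕ → Set
InInterval lo i x = lo ≤ x × x < lo + i

unique-length≤sumFrom : ∀ h lo i {L} → Unique L → All (λ x → InInterval lo i x × 1 ≤ h x) L → length L ≤ sumFrom h lo i
unique-length≤sumFrom h lo zero {[]}    _ _ = z≤n
unique-length≤sumFrom h lo zero {x ∷ L} _ (((lo≤x , x<lo+0) , _) ∷ _) =
  ⊥-elim (<-irrefl refl (≤-<-trans lo≤x (subst (x <_) (+-identityʳ lo) x<lo+0)))
unique-length≤sumFrom h lo (suc i) {L} L! L⊆ = begin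
  length L              ≤⟨ length≤length-L′+h[z] ⟩
  length L′ + h z       ≤⟨ +-monoˡ-≤ (h z) (unique-length≤sumFrom h lo i (Unique.filter⁺ ≢z? L!) L′⊆) ⟩
  sumFrom h lo i + h z  ∎
  where
  open ≤-Reasoning
  z : ℕ
  z = lo + i
  ≢z? : Decidable (λ x → ¬ x ≡ z)
  ≢z? x = ¬? (x ≟ z)
  L′ : List ℕ
  L′ = filter ≢z? L
  L′⊆ : All (λ x → InInterval lo i x × 1 ≤ h x) L′
  L′⊆ = All.zipWith shrink (All.all-filter ≢z? L , All.filter⁺ ≢z? L⊆)
    where
    shrink : ∀ {x} → ¬ x ≡ z × (InInterval lo (suc i) x × 1 ≤ h x) → InInterval lo i x × 1 ≤ h x
    shrink {x} (x≢z , (lo≤x , x<lo+1+i) , 1≤hx) =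
      (lo≤x , ≤∧≢⇒< (s≤s⁻¹ (subst (x <_) (+-suc lo i) x<lo+1+i)) x≢z) , 1≤hx
  length≤length-L′+h[z] : length L ≤ length L′ + h z
  length≤length-L′+h[z] with h z in h[z]≡
  ... | zero  = ≤-reflexive (trans (cong length (sym (filter-all ≢z? (All.map z∉ L⊆)))) (sym (+-identityʳ _)))
    where
    z∉ : ∀ {x} → InInterval lo (suc i) x × 1 ≤ h x → ¬ x ≡ z
    z∉ (_ , 1≤hx) refl with () ← subst (1 ≤_) h[z]≡ 1≤hx
  ... | suc k = ≤-trans (length≤1+length-filter-≢ z L!) (≤-trans (s≤s (m≤m+n _ k)) (≤-reflexive (sym (+-suc _ k))))

indicator : {A : Set} → Dec A → ℕ
indicator (yes _) = 1
indicator (no  _) = 0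

indicator≤1 : {A : Set} (a? : Dec A) → indicator a? ≤ 1
indicator≤1 (yes _) = ≤-refl
indicator≤1 (no  _) = z≤n

indicator-yes : {A : Set} (a? : Dec A) → A → 1 ≤ indicator a?
indicator-yes (yes _) _ = ≤-refl
indicator-yes (no ¬a) a = ⊥-elim (¬a a)

length-filter-downFrom : ∀ {P : ℕ → Set} (P? : Decidable P) n →
                         length (filter P? (downFrom n)) ≡ sumFrom (λ x → indicator (P? x)) 0 n
length-filter-downFrom P? zero    = refl
length-filter-downFrom P? (suc n) with P? n
... | yes _ = trans (cong suc (length-filter-downFrom P? n)) (+-comm 1 _)
... | no  _ = trans (length-filter-downFrom P? n) (sym (+-identityʳ _))

atLeast-sumFrom-indicator : ∀ {P : ℕ → Set} (P? : Decidable P) n → AtLeast P (sumFrom (λ x → indicator (P? x)) 0 n) n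
atLeast-sumFrom-indicator P? n =
  filter P? (downFrom n) ,
  Unique.filter⁺ P? (Unique.downFrom⁺ n) ,
  All.zip (All.filter⁺ P? (All.tabulate ∈-downFrom⁻) , All.all-filter P? (downFrom n)) ,
  length-filter-downFrom P? n

-- Deficits

-- k is at least ℓ - e/M, kept in integer form.
record DeficitAtMost (M e k ℓ : ℕ) : Set where
  constructor deficit
  field bound : M * ℓ ≤ M * k + e
open DeficitAtMost public

module _ {M : ℕ} where
  open ≤-Reasoning

  deficit-mono : ∀ {e e′ k k′ ℓ} → e ≤ e′ → k ≤ k′ → DeficitAtMost M e k ℓ → DeficitAtMost M e′ k′ ℓ
  deficit-mono e≤e′ k≤k′ (deficit d) = deficit (≤-trans d (+-mono-≤ (*-monoʳ-≤ M k≤k′) e≤e′))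

  deficit-+ : ∀ {e e′ k k′ ℓ ℓ′} → DeficitAtMost M e k ℓ → DeficitAtMost M e′ k′ ℓ′ →
              DeficitAtMost M (e + e′) (k + k′) (ℓ + ℓ′)
  deficit-+ {e} {e′} {k} {k′} {ℓ} {ℓ′} (deficit d) (deficit d′) = deficit (begin
    M * (ℓ + ℓ′)                ≡⟨ *-distribˡ-+ M ℓ ℓ′ ⟩
    M * ℓ + M * ℓ′              ≤⟨ +-mono-≤ d d′ ⟩
    (M * k + e) + (M * k′ + e′) ≡⟨ +-interchange (M * k) e (M * k′) e′ ⟩
    (M * k + M * k′) + (e + e′) ≡⟨ cong (_+ (e + e′)) (*-distribˡ-+ M k k′) ⟨
    M * (k + k′) + (e + e′)     ∎)

  deficit-cancel : ∀ {e k j ℓ ℓ′} → j ≤ ℓ′ → DeficitAtMost M e (k + j) (ℓ + ℓ′) → DeficitAtMost M e k ℓ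
  deficit-cancel {e} {k} {j} {ℓ} {ℓ′} j≤ℓ′ (deficit d) = deficit (+-cancelʳ-≤ (M * ℓ′) _ _ (begin
    M * ℓ + M * ℓ′              ≡⟨ *-distribˡ-+ M ℓ ℓ′ ⟨
    M * (ℓ + ℓ′)                ≤⟨ d ⟩
    M * (k + j) + e             ≤⟨ +-monoˡ-≤ e (*-monoʳ-≤ M (+-monoʳ-≤ k j≤ℓ′)) ⟩
    M * (k + ℓ′) + e            ≡⟨ cong (_+ e) (*-distribˡ-+ M k ℓ′) ⟩
    M * k + M * ℓ′ + e          ≡⟨ xy∙z≈xz∙y (M * k) (M * ℓ′) e ⟩
    M * k + e + M * ℓ′          ∎))

  deficit-absorb : ∀ {e e′ k j ℓ} → M * j ≤ e′ → DeficitAtMost M e (k + j) ℓ → DeficitAtMost M (e + e′) k ℓ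
  deficit-absorb {e} {e′} {k} {j} {ℓ} Mj≤e′ (deficit d) = deficit (begin
    M * ℓ                       ≤⟨ d ⟩
    M * (k + j) + e             ≡⟨ cong (_+ e) (*-distribˡ-+ M k j) ⟩
    M * k + M * j + e           ≤⟨ +-monoˡ-≤ e (+-monoʳ-≤ (M * k) Mj≤e′) ⟩
    M * k + e′ + e              ≡⟨ xy∙z≈xz∙y (M * k) e′ e ⟩
    M * k + e + e′              ≡⟨ +-assoc (M * k) e e′ ⟩
    M * k + (e + e′)            ∎)

  deficit⇒complement≤ : ∀ {e k j} → DeficitAtMost M e k (k + j) → M * j ≤ e
  deficit⇒complement≤ {e} {k} {j} (deficit d) = +-cancelˡ-≤ (M * k) _ _ (begin
    M * k + M * j               ≡⟨ *-distribˡ-+ M k j ⟨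
    M * (k + j)                 ≤⟨ d ⟩
    M * k + e                   ∎)

deficit-*-cancel : ∀ c {M e k ℓ} → .{{NonZero c}} → DeficitAtMost (c * M) (c * e) k ℓ → DeficitAtMost M e k ℓ
deficit-*-cancel c {M} {e} {k} {ℓ} (deficit d) = deficit (*-cancelˡ-≤ c (begin
  c * (M * ℓ)                   ≡⟨ *-assoc c M ℓ ⟨
  c * M * ℓ                     ≤⟨ d ⟩
  c * M * k + c * e             ≡⟨ cong (_+ c * e) (*-assoc c M k) ⟩
  c * (M * k) + c * e           ≡⟨ *-distribˡ-+ c (M * k) e ⟨
  c * (M * k + e)               ∎))
  where open ≤-Reasoning

deficit-halve : ∀ {M e k ℓ} → DeficitAtMost (M + M) (e + e) k ℓ → DeficitAtMost M e k ℓ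
deficit-halve {M} {e} {k} {ℓ} =
  deficit-*-cancel 2 ∘′ subst₂ (λ M′ e′ → DeficitAtMost M′ e′ k ℓ) (double M) (double e)
  where
  double : ∀ m → m + m ≡ 2 * m
  double m = cong (_+_ m) (sym (+-identityʳ m))

-- Rational bounds

toℚᵘ-ℕ→ℚ : ∀ n → toℚᵘ (ℕ→ℚ n) ℚᵘ.≃ ℚᵘ.mkℚᵘ (+ n) 0
toℚᵘ-ℕ→ℚ n = ℚ.toℚᵘ-fromℚᵘ (ℚᵘ.mkℚᵘ (+ n) 0)

drop-*ℕ≤ℕ : ∀ x n k → x ℚ.* ℕ→ℚ n ℚ.≤ ℕ→ℚ k → ↥ x ℤ.* + n ℤ.≤ + k ℤ.* ↧ x
drop-*ℕ≤ℕ x@(mkℚ p d _) n k x*n≤k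
  with ℚᵘ.*≤* ≤ᵘ ← ℚᵘ.≤-respʳ-≃ (toℚᵘ-ℕ→ℚ k)
                     (ℚᵘ.≤-respˡ-≃ (ℚᵘ.*-congˡ {toℚᵘ x} (toℚᵘ-ℕ→ℚ n))
                       (ℚᵘ.≤-respˡ-≃ (ℚ.toℚᵘ-homo-* x (ℕ→ℚ n)) (ℚ.toℚᵘ-mono-≤ x*n≤k)))
  = subst₂ ℤ._≤_ (ℤ.*-identityʳ (p ℤ.* + n)) (cong (λ z → + k ℤ.* + suc z) (*-identityʳ d)) ≤ᵘ

*ℕ≤ℕ-intro : ∀ x n k → ↥ x ℤ.* + n ℤ.≤ + k ℤ.* ↧ x → x ℚ.* ℕ→ℚ n ℚ.≤ ℕ→ℚ k
*ℕ≤ℕ-intro x@(mkℚ p d _) n k ≤ℤ = ℚ.toℚᵘ-cancel-≤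
  (ℚᵘ.≤-respˡ-≃ (ℚᵘ.≃-sym (ℚ.toℚᵘ-homo-* x (ℕ→ℚ n)))
    (ℚᵘ.≤-respˡ-≃ (ℚᵘ.*-congˡ {toℚᵘ x} (ℚᵘ.≃-sym (toℚᵘ-ℕ→ℚ n)))
      (ℚᵘ.≤-respʳ-≃ (ℚᵘ.≃-sym (toℚᵘ-ℕ→ℚ k))
        (ℚᵘ.*≤* (subst₂ ℤ._≤_ (sym (ℤ.*-identityʳ (p ℤ.* + n))) (cong (λ z → + k ℤ.* + suc z) (sym (*-identityʳ d)))
                        ≤ℤ)))))

t/[1+t] : ℕ → ℚ
t/[1+t] t = mkℚ (+ t) t (subst (Coprime t) (+-comm t 1) (coprime-sym (coprime-+ (1-coprimeTo t))))

t/[1+t]<1 : ∀ t → t/[1+t] t ℚ.< 1ℚ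
t/[1+t]<1 t = *<* (subst₂ ℤ._<_ (sym (ℤ.*-identityʳ (+ t))) (sym (ℤ.*-identityˡ (+ suc t))) (ℤ.+<+ (n<1+n t)))

1-[1-x]≡x : ∀ x → 1ℚ ℚ.- (1ℚ ℚ.- x) ≡ x
1-[1-x]≡x x = begin
  1ℚ ℚ.- (1ℚ ℚ.- x)  ≡⟨ cong (λ z → 1ℚ ℚ.+ z) (⁻¹-anti-homo‿- 1ℚ x) ⟩
  1ℚ ℚ.+ (x ℚ.- 1ℚ)  ≡⟨ sym (ℚ.+-assoc 1ℚ x (ℚ.- 1ℚ)) ⟩
  1ℚ ℚ.+ x ℚ.- 1ℚ    ≡⟨ xyx⁻¹≈y 1ℚ x ⟩
  x              ∎
  where open ≡-Reasoning

p<q⇒0<q-p : ∀ {p q} → p ℚ.< q → 0ℚ ℚ.< q ℚ.- p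
p<q⇒0<q-p {p} {q} p<q = subst (ℚ._< q ℚ.- p) (ℚ.+-inverseʳ p) (ℚ.+-monoˡ-< (ℚ.- p) p<q)

t/[1+t]*ℕ≤ℕ⇒deficit : ∀ t n k → t/[1+t] t ℚ.* ℕ→ℚ n ℚ.≤ ℕ→ℚ k → DeficitAtMost (suc t) n k n
t/[1+t]*ℕ≤ℕ⇒deficit t n k t*n≤k = deficit (begin
  n + t * n       ≤⟨ +-monoʳ-≤ n (ℤ.drop‿+≤+ t*n≤k*[1+t]) ⟩
  n + k * suc t   ≡⟨ +-comm n _ ⟩
  k * suc t + n   ≡⟨ cong (_+ n) (*-comm k (suc t)) ⟩
  suc t * k + n   ∎)
  where
  open ≤-Reasoning
  t*n≤k*[1+t] : + (t * n) ℤ.≤ + (k * suc t)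
  t*n≤k*[1+t] = subst₂ ℤ._≤_ (sym (ℤ.pos-* t n)) (sym (ℤ.pos-* k (suc t))) (drop-*ℕ≤ℕ (t/[1+t] t) n k t*n≤k)

-- Density one at ε = 1 - t/(t+1).
densityOne⇒deficit : ∀ {A} → DensityOne A → ∀ t →
                     ∃[ N ] ∀ n → N ≤ n → ∃[ k ] AtLeast A k n × DeficitAtMost (suc t) n k n
densityOne⇒deficit dense t with N , A-dense ← dense (1ℚ ℚ.- t/[1+t] t) (p<q⇒0<q-p (t/[1+t]<1 t)) =
  N , λ n N≤n → let k , k∈A , bound = A-dense n N≤n in
    k , k∈A , t/[1+t]*ℕ≤ℕ⇒deficit t n k (subst (λ r → r ℚ.* ℕ→ℚ n ℚ.≤ ℕ→ℚ k) (1-[1-x]≡x (t/[1+t] t)) bound)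

-- r = p/q < 1 forces p ≤ q - 1, so r·n ≤ n - n/q.
deficit⇒*ℕ≤ℕ : ∀ r n k → r ℚ.< 1ℚ → DeficitAtMost (↧ₙ r) n k n → r ℚ.* ℕ→ℚ n ℚ.≤ ℕ→ℚ k
deficit⇒*ℕ≤ℕ r@(mkℚ p d _) n k (*<* p*1<1*q) (deficit q*n≤q*k+n) =
  *ℕ≤ℕ-intro r n k (numerator≤ p (subst₂ ℤ._<_ (ℤ.*-identityʳ p) (ℤ.*-identityˡ (+ suc d)) p*1<1*q))
  where
  numerator≤ : ∀ p → p ℤ.< + suc d → p ℤ.* + n ℤ.≤ + k ℤ.* + suc d
  numerator≤ -[1+ a ] _ = ℤ.≤-trans (ℤ.*-monoʳ-≤-nonNeg (+ n) (ℤ.-≤+ {a} {0}))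
                                    (subst (+ 0 ℤ.≤_) (ℤ.pos-* k (suc d)) (ℤ.+≤+ z≤n))
  numerator≤ (+ a) (ℤ.+<+ a<1+d) = subst₂ ℤ._≤_ (ℤ.pos-* a n) (ℤ.pos-* k (suc d)) (ℤ.+≤+ (+-cancelʳ-≤ n _ _ (begin
    a * n + n       ≡⟨ +-comm (a * n) n ⟩
    suc a * n         ≤⟨ *-monoˡ-≤ n a<1+d ⟩
    suc d * n         ≤⟨ q*n≤q*k+n ⟩
    suc d * k + n   ≡⟨ cong (_+ n) (*-comm (suc d) k) ⟩
    k * suc d + n   ∎)))
    where open ≤-Reasoning

[r-ε]*n≤r*n : ∀ r ε n → 0ℚ ℚ.< ε → (r ℚ.- ε) ℚ.* ℕ→ℚ n ℚ.≤ r ℚ.* ℕ→ℚ n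
[r-ε]*n≤r*n r ε n 0<ε = ℚ.*-monoʳ-≤-nonNeg (ℕ→ℚ n) {{ℚ.normalize-nonNeg n 1}}
  (subst (r ℚ.- ε ℚ.≤_) (ℚ.+-identityʳ r) (ℚ.+-monoʳ-≤ r (ℚ.neg-antimono-≤ (ℚ.<⇒≤ 0<ε))))

-- The construction

module Construction (g : ℕ → ℕ) (c : Code 1) (M N : ℕ)
  (dense : ∀ n → N ≤ n → ∃[ k ] AtLeast (λ x → c ⟦ x ⟧≡ g x) k n × DeficitAtMost (M + M) n k n) where

  Agrees : ℕ → Set
  Agrees x = c ⟦ x ⟧≡ g x

  B₀ : ℕ
  B₀ = suc N

  run : ℕ → ℕ → ℕ
  run S x = encode (eval S c (x ∷ []))

  halted : ℕ → ℕ → ℕ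
  halted S x = ifz (run S x) 0 1

  halted≤1 : ∀ S x → halted S x ≤ 1
  halted≤1 S x with run S x
  ... | zero  = z≤n
  ... | suc _ = ≤-refl

  halts-by : ∀ {S k x y} → k ≤ S → eval k c (x ∷ []) ≡ just y → 1 ≤ halted S x
  halts-by {S} {x = x} k≤S e = subst (λ r → 1 ≤ ifz (encode r) 0 1) (sym (eval-mono c (x ∷ []) k≤S e)) ≤-refl

  halted-mono : ∀ {S S′} x → S ≤ S′ → 1 ≤ halted S x → 1 ≤ halted S′ x
  halted-mono {S} x S≤S′ h with eval S c (x ∷ []) in e
  ... | just _ = halts-by S≤S′ e

  halted-eventually : ∀ {L} → All Agrees L → ∃[ S ] All (λ x → 1 ≤ halted S x) L
  halted-eventually []               = 0 , []
  halted-eventually ((k , e) ∷ agree) with S , h ← halted-eventually agree =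
    k ⊔ S , halts-by (m≤m⊔n k S) e ∷ All.map (λ {x} → halted-mono x (m≤n⊔m k S)) h

  halted⇒correct : ∀ S x → Agrees x → 1 ≤ halted S x → pred (run S x) ≡ g x
  halted⇒correct S x (k , e) h with eval S c (x ∷ []) in e′
  ... | just y = just-injective (trans (sym (eval-mono c (x ∷ []) (m≤m⊔n S k) e′)) (eval-mono c (x ∷ []) (m≤n⊔m S k) e))

  haltedIn : ℕ → ℕ → ℕ
  haltedIn S b = sumFrom (halted S) b b

  -- Zero iff M·b ≤ M·(haltedIn S b) + b, with truncated subtraction as the ≤-test; below B₀ every stage
  -- passes, which keeps the search for a stage total.
  blockTest : ℕ → ℕ → ℕ
  blockTest S b = ifz (B₀ ∸ b) (M * b ∸ (M * haltedIn S b + b)) 0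

  -- At most b/M points of [0, 2b) lie outside the agreement set, hence at most b/M points of [b, 2b).
  agreements-in-block : ∀ b → B₀ ≤ b →
    Σ (List ℕ) λ L → Unique L × All (λ x → InInterval b b x × Agrees x) L × DeficitAtMost M b (length L) b
  agreements-in-block b B₀≤b
    with k , (L , L! , L⊆ , |L|≡k) , L-deficit ← dense (b + b) (≤-trans (n≤1+n N) (≤-trans B₀≤b (m≤m+n b b))) =
    filter (b ≤?_) L ,
    Unique.filter⁺ (b ≤?_) L! ,
    All.zipWith (λ (b≤x , x<b+b , agree) → (b≤x , x<b+b) , agree) (All.all-filter (b ≤?_) L , All.filter⁺ (b ≤?_) L⊆) ,
    deficit-cancel below≤b (subst (λ k → DeficitAtMost M b k (b + b))
                                  (sym (trans (length-filter-partition (b ≤?_) L) |L|≡k)) (deficit-halve L-deficit))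
    where
    below≤b : length (filter (λ x → ¬? (b ≤? x)) L) ≤ b
    below≤b = ≤-trans (unique-length≤sumFrom (λ _ → 1) 0 b (Unique.filter⁺ _ L!)
                         (All.map (λ b≰x → (z≤n , ≰⇒> b≰x) , ≤-refl) (All.all-filter _ L)))
                      (sumFrom-≤ (λ _ → ≤-refl) 0 b)

  blockTest-≥B₀ : ∀ S {b} → B₀ ≤ b → blockTest S b ≡ M * b ∸ (M * haltedIn S b + b)
  blockTest-≥B₀ S {b} B₀≤b = cong (λ d → ifz d (M * b ∸ (M * haltedIn S b + b)) 0) (m≤n⇒m∸n≡0 B₀≤b)

  blockTest-<B₀ : ∀ S {b} → b < B₀ → blockTest S b ≡ 0
  blockTest-<B₀ S {b} b<B₀ with B₀ ∸ b in e
  ... | zero  = contradiction (m∸n≡0⇒m≤n e) (<⇒≱ b<B₀)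
  ... | suc _ = refl

  blockTest-sound : ∀ S {b} → B₀ ≤ b → blockTest S b ≡ 0 → DeficitAtMost M b (haltedIn S b) b
  blockTest-sound S B₀≤b pass = deficit (m∸n≡0⇒m≤n (trans (sym (blockTest-≥B₀ S B₀≤b)) pass))

  blockTest-solvable : ∀ b → ∃[ S ] blockTest S b ≡ 0
  blockTest-solvable b with B₀ ≤? b
  ... | no  B₀≰b = 0 , blockTest-<B₀ 0 (≰⇒> B₀≰b)
  ... | yes B₀≤b with agreements-in-block b B₀≤b
  ... | L , L! , L⊆ , L-deficit with halted-eventually (All.map proj₂ L⊆)
  ... | S , halted-on-L = S , trans (blockTest-≥B₀ S B₀≤b) (m≤n⇒m∸n≡0 (bound (deficit-mono ≤-refl |L|≤halted L-deficit)))
    where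
    |L|≤halted : length L ≤ haltedIn S b
    |L|≤halted = unique-length≤sumFrom (halted S) b b L! (All.zipWith (λ ((inBlock , _) , h) → inBlock , h) (L⊆ , halted-on-L))

  run-computable : ∀ {n S X} → Computableₙ n S → Computableₙ n X → Computableₙ n (λ xs → run (S xs) (X xs))
  run-computable s x = ∘-computable (eval-computable c) (∷-computable s (∷-computable x []-computable))

  blockTest-computable : Computableₙ 2 (λ v → blockTest (lookup v zero) (lookup v (suc zero)))
  blockTest-computable = computable-cong
    (ifz-computable (∸-computable (const-computable B₀) b)
                    (∸-computable (*-computable M b) (+-computable (*-computable M haltedIn-computable) b))
                    zero-computable)
    λ { (_ ∷ _ ∷ []) → refl }
    where
    b : Computableₙ 2 (λ v → lookup v (suc zero))
    b = proj-computable (suc zero)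
    haltedIn-computable : Computableₙ 2 (λ v → haltedIn (lookup v zero) (lookup v (suc zero)))
    haltedIn-computable = computable-cong
      (∘-computable (sumFrom-computable {H = λ ps → halted (head ps)} halted-computable)
                    (∷-computable b (∷-computable b (∷-computable (proj-computable zero) []-computable))))
      λ { (_ ∷ _ ∷ []) → refl }
      where
      halted-computable : Computableₙ 2 (λ v → halted (head (tail v)) (head v))
      halted-computable = computable-cong
        (ifz-computable (run-computable (proj-computable (suc zero)) (proj-computable zero)) zero-computable (const-computable 1))
        λ { (_ ∷ _ ∷ []) → refl }

  blockStage-search : Σ (Vec ℕ 1 → ℕ) λ G → Computableₙ 1 G × (∀ xs → blockTest (G xs) (lookup xs zero) ≡ 0)
  blockStage-search = μ-computable blockTest-computable λ { (b ∷ []) → blockTest-solvable b }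

  -- Opaque because unfolding the μ-search during unification exhausts memory.
  opaque
    blockStage : ℕ → ℕ
    blockStage b = proj₁ blockStage-search (b ∷ [])

    blockStage-passes : ∀ b → blockTest (blockStage b) b ≡ 0
    blockStage-passes b = proj₂ (proj₂ blockStage-search) (b ∷ [])

    blockStage-computable : Computableₙ 1 (λ v → blockStage (head v))
    blockStage-computable = computable-cong (proj₁ (proj₂ blockStage-search)) λ { (_ ∷ []) → refl }

  -- The blocks are [B₀, 2B₀), [2B₀, 4B₀), …: the start b doubles when x + 1 reaches 2b.
  blockStep : Vec ℕ 2 → ℕ
  blockStep (x ∷ b ∷ []) = ifz ((b + b) ∸ suc x) (b + b) b

  blockStart : ℕ → ℕ
  blockStart x = primRec (λ _ → B₀) blockStep (x ∷ [])

  blockStart-computable : Computableₙ 1 (λ v → blockStart (head v))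
  blockStart-computable = computable-cong
    (primRec-computable (const-computable B₀)
      (computable-cong (ifz-computable (∸-computable b+b (suc∘-computable (proj-computable zero))) b+b (proj-computable (suc zero)))
                       λ { (_ ∷ _ ∷ []) → refl }))
    λ { (_ ∷ []) → refl }
    where
    b+b : Computableₙ 2 (λ v → lookup v (suc zero) + lookup v (suc zero))
    b+b = +-computable (proj-computable (suc zero)) (proj-computable (suc zero))

  -- 0 wherever c has not halted by the chosen stage.
  stagedGuess : ℕ → ℕ → ℕ
  stagedGuess b x = pred (run (blockStage b) x)

  f : ℕ → ℕ
  f x = stagedGuess (blockStart x) x

  f-computable : Computable f
  f-computable = let (code , f⇓) = fⁿ in code , λ x → f⇓ (x ∷ [])
    where
    fⁿ : Computableₙ 1 (λ v → f (head v))
    fⁿ = computable-cong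
      (pred-computable (run-computable (∘-computable blockStage-computable (∷-computable blockStart-computable []-computable))
                                       (proj-computable zero)))
      λ { (_ ∷ []) → refl }

  B₀≤blockStart : ∀ x → B₀ ≤ blockStart x
  B₀≤blockStart zero    = ≤-refl
  B₀≤blockStart (suc x) with (blockStart x + blockStart x) ∸ suc x
  ... | zero  = ≤-trans (B₀≤blockStart x) (m≤m+n _ _)
  ... | suc _ = B₀≤blockStart x

  blockStart-small : ∀ x → x ≤ B₀ → blockStart x ≡ B₀
  blockStart-small zero    _     = refl
  blockStart-small (suc x) 1+x≤B₀ rewrite blockStart-small x (≤-trans (n≤1+n x) 1+x≤B₀)
    with (B₀ + B₀) ∸ suc x in e
  ... | zero  = contradiction (m∸n≡0⇒m≤n e) (<⇒≱ (≤-<-trans 1+x≤B₀ (m<m+n B₀ (s≤s z≤n))))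
  ... | suc _ = refl

  blockStart-suc : ∀ x {b} → blockStart x ≡ b → x < b + b →
                   (suc x ≡ b + b × blockStart (suc x) ≡ b + b) ⊎ (suc x < b + b × blockStart (suc x) ≡ b)
  blockStart-suc x refl x<b+b with (blockStart x + blockStart x) ∸ suc x in e
  ... | zero  = inj₁ (≤-antisym x<b+b (m∸n≡0⇒m≤n e) , refl)
  ... | suc _ = inj₂ (≰⇒> (λ b+b≤1+x → 1+n≢0 (trans (sym e) (m≤n⇒m∸n≡0 b+b≤1+x))) , refl)

  blockStart-const : ∀ {b} → blockStart b ≡ b → ∀ d → d < b → blockStart (b + d) ≡ b
  blockStart-const {b} start zero    _   = trans (cong blockStart (+-identityʳ b)) start
  blockStart-const {b} start (suc d) 1+d<b with blockStart-suc (b + d) (blockStart-const start d (<-trans (n<1+n d) 1+d<b))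
                                                                 (+-monoʳ-< b (<-trans (n<1+n d) 1+d<b))
  ... | inj₁ (1+b+d≡b+b , _) = contradiction (+-cancelˡ-≡ b (suc d) b (trans (+-suc b d) 1+b+d≡b+b)) (<⇒≢ 1+d<b)
  ... | inj₂ (_ , next≡b)     = trans (cong blockStart (+-suc b d)) next≡b

  InBlock : ℕ → ℕ → Set
  InBlock b x = blockStart b ≡ b × b ≤ x × x < b + b

  blockStart-inBlock : ∀ x → B₀ ≤ x → InBlock (blockStart x) x
  blockStart-inBlock (suc x) B₀≤1+x with B₀ ≤? x
  ... | no B₀≰x = subst (λ b → InBlock b (suc x)) (sym first)
                        (blockStart-small B₀ ≤-refl , B₀≤1+x , ≤-<-trans (≰⇒> B₀≰x) (m<m+n B₀ (s≤s z≤n)))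
    where
    first : blockStart (suc x) ≡ B₀
    first = blockStart-small (suc x) (≰⇒> B₀≰x)
  ... | yes B₀≤x with blockStart-inBlock x B₀≤x
  ... | start , b≤x , x<b+b with blockStart-suc x refl x<b+b
  ... | inj₁ (1+x≡b+b , next≡b+b) = subst (λ b′ → InBlock b′ (suc x)) (sym next≡b+b)
    (trans (cong blockStart (sym 1+x≡b+b)) next≡b+b , ≤-reflexive (sym 1+x≡b+b) ,
     subst (_< (b + b) + (b + b)) (sym 1+x≡b+b) (m<m+n (b + b) (≤-trans (s≤s z≤n) (≤-trans (B₀≤blockStart x) (m≤m+n b b)))))
    where
    b : ℕ
    b = blockStart x
  ... | inj₂ (1+x<b+b , next≡b)    = subst (λ b′ → InBlock b′ (suc x)) (sym next≡b) (start , m≤n⇒m≤1+n b≤x , 1+x<b+b)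

  agreeCount : (ℕ → ℕ) → ℕ → ℕ → ℕ
  agreeCount h lo i = sumFrom (λ x → indicator (h x ≟ g x)) lo i

  block-agreement : ∀ b → B₀ ≤ b → DeficitAtMost M (b + b) (agreeCount (stagedGuess b) b b) b
  block-agreement b B₀≤b with agreements-in-block b B₀≤b
  ... | L , L! , L⊆ , L-deficit = deficit-absorb M*unhalted≤b (deficit-mono ≤-refl |L|≤agreed+unhalted L-deficit)
    where
    S : ℕ
    S = blockStage b
    unhalted : ℕ
    unhalted = sumFrom (λ x → 1 ∸ halted S x) b b
    M*unhalted≤b : M * unhalted ≤ b
    M*unhalted≤b = deficit⇒complement≤ (subst (DeficitAtMost M b (haltedIn S b)) (sym (sumFrom-complement (halted≤1 S) b b))
                                             (blockTest-sound S B₀≤b (blockStage-passes b)))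
    halted? : Decidable (λ x → 1 ≤ halted S x)
    halted? x = 1 ≤? halted S x
    unhalted-indicator : ∀ {x} → ¬ 1 ≤ halted S x → 1 ≤ 1 ∸ halted S x
    unhalted-indicator {x} ¬h with halted S x
    ... | zero  = ≤-refl
    ... | suc _ = contradiction (s≤s z≤n) ¬h
    |L|≤agreed+unhalted : length L ≤ agreeCount (stagedGuess b) b b + unhalted
    |L|≤agreed+unhalted = subst (_≤ agreeCount (stagedGuess b) b b + unhalted) (length-filter-partition halted? L) (+-mono-≤
      (unique-length≤sumFrom _ b b (Unique.filter⁺ halted? L!)
        (All.zipWith (λ {x} (h , inBlock , agrees) → inBlock , indicator-yes (stagedGuess b x ≟ g x) (halted⇒correct S x agrees h))
                     (All.all-filter halted? L , All.filter⁺ halted? L⊆)))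
      (unique-length≤sumFrom _ b b (Unique.filter⁺ _ L!)
        (All.zipWith (λ (¬h , inBlock , _) → inBlock , unhalted-indicator ¬h)
                     (All.all-filter (λ x → ¬? (halted? x)) L , All.filter⁺ _ L⊆))))

  agreeCount-f-in-block : ∀ {b} → blockStart b ≡ b → ∀ i → i ≤ b → agreeCount f b i ≡ agreeCount (stagedGuess b) b i
  agreeCount-f-in-block {b} start i i≤b = sumFrom-cong b i λ x b≤x x<b+i →
    cong (λ b′ → indicator (stagedGuess b′ x ≟ g x)) (same-block x b≤x (≤-trans x<b+i (+-monoʳ-≤ b i≤b)))
    where
    same-block : ∀ x → b ≤ x → x < b + b → blockStart x ≡ b
    same-block x b≤x x<b+b =
      trans (cong blockStart (sym b+[x∸b]≡x))
            (blockStart-const start (x ∸ b) (+-cancelˡ-< b (x ∸ b) b (subst (_< b + b) (sym b+[x∸b]≡x) x<b+b)))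
      where
      b+[x∸b]≡x : b + (x ∸ b) ≡ x
      b+[x∸b]≡x = m+[n∸m]≡n b≤x

  blockStart-induction : (P : ℕ → Set) → P B₀ → (∀ b → B₀ ≤ b → blockStart b ≡ b → P b → P (b + b)) →
                         ∀ x → B₀ ≤ x → P (blockStart x)
  blockStart-induction P base step (suc x) B₀≤1+x with B₀ ≤? x
  ... | no B₀≰x = subst P (sym (blockStart-small (suc x) (≰⇒> B₀≰x))) base
  ... | yes B₀≤x with blockStart-inBlock x B₀≤x
  ... | start , _ , x<b+b with blockStart-suc x refl x<b+b
  ... | inj₁ (_ , next≡b+b) = subst P (sym next≡b+b) (step _ (B₀≤blockStart x) start IH)
    where
    IH : P (blockStart x)
    IH = blockStart-induction P base step x B₀≤x
  ... | inj₂ (_ , next≡b)   = subst P (sym next≡b) (blockStart-induction P base step x B₀≤x)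

  PrefixDeficit : ℕ → Set
  PrefixDeficit b = DeficitAtMost M (M * B₀ + (b + b)) (agreeCount f 0 b) b

  blockStart-prefixDeficit : ∀ x → B₀ ≤ x → PrefixDeficit (blockStart x)
  blockStart-prefixDeficit = blockStart-induction PrefixDeficit
    (deficit (≤-trans (m≤m+n (M * B₀) (B₀ + B₀)) (m≤n+m _ (M * agreeCount f 0 B₀))))
    λ b B₀≤b start prefix →
      subst₂ (λ e k → DeficitAtMost M e k (b + b))
             (+-assoc (M * B₀) (b + b) (b + b))
             (trans (cong (_+_ (agreeCount f 0 b)) (sym (agreeCount-f-in-block start b ≤-refl))) (sym (sumFrom-+ _ 0 b b)))
             (deficit-+ prefix (block-agreement b B₀≤b))

  partial-block-agreement : ∀ {b} j → B₀ ≤ b → blockStart b ≡ b → j ≤ b → DeficitAtMost M (b + b) (agreeCount f b j) j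
  partial-block-agreement {b} j B₀≤b start j≤b =
    subst (λ k → DeficitAtMost M (b + b) k j) (sym (agreeCount-f-in-block start j j≤b))
      (deficit-cancel (sumFrom-≤ (λ x → indicator≤1 (stagedGuess b x ≟ g x)) (b + j) (b ∸ j))
        (subst₂ (DeficitAtMost M (b + b)) (trans (cong (agreeCount (stagedGuess b) b) (sym j+[b∸j]≡b)) (sumFrom-+ _ b j (b ∸ j)))
                                          (sym j+[b∸j]≡b)
                (block-agreement b B₀≤b)))
    where
    j+[b∸j]≡b : j + (b ∸ j) ≡ b
    j+[b∸j]≡b = m+[n∸m]≡n j≤b

  f-deficit : ∀ n → B₀ ≤ n → DeficitAtMost M (M * B₀ + 4 * n) (agreeCount f 0 n) n
  f-deficit n B₀≤n with blockStart n | blockStart-inBlock n B₀≤n | blockStart-prefixDeficit n B₀≤n | B₀≤blockStart n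
  ... | b | start , b≤n , n<b+b | prefix | B₀≤b =
    subst₂ (DeficitAtMost M _) (trans (sym (sumFrom-+ _ 0 b (n ∸ b))) (cong (agreeCount f 0) b+[n∸b]≡n)) b+[n∸b]≡n
      (deficit-mono error≤ ≤-refl (deficit-+ prefix (partial-block-agreement (n ∸ b) B₀≤b start n∸b≤b)))
    where
    b+[n∸b]≡n : b + (n ∸ b) ≡ n
    b+[n∸b]≡n = m+[n∸m]≡n b≤n
    n∸b≤b : n ∸ b ≤ b
    n∸b≤b = <⇒≤ (+-cancelˡ-< b (n ∸ b) b (subst (_< b + b) (sym b+[n∸b]≡n) n<b+b))
    error≤ : M * B₀ + (b + b) + (b + b) ≤ M * B₀ + 4 * n
    error≤ = begin
      M * B₀ + (b + b) + (b + b)   ≡⟨ +-assoc (M * B₀) (b + b) (b + b) ⟩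
      M * B₀ + ((b + b) + (b + b)) ≡⟨ cong (_+_ (M * B₀)) (four-times b) ⟩
      M * B₀ + 4 * b               ≤⟨ +-monoʳ-≤ (M * B₀) (*-monoʳ-≤ 4 b≤n) ⟩
      M * B₀ + 4 * n               ∎
      where
      open ≤-Reasoning
      four-times : ∀ m → (m + m) + (m + m) ≡ 4 * m
      four-times = solve-∀

corollary2p2 : (g : ℕ → ℕ) → DenselyComputable g → GammaOne g
corollary2p2 g (c , c≈g) r r<1 = f , f-computable , λ ε 0<ε → 2 * q * B₀ , λ n 2qB₀≤n →
  agreeCount f 0 n , atLeast-sumFrom-indicator (λ x → f x ≟ g x) n ,
  ℚ.≤-trans ([r-ε]*n≤r*n r ε n 0<ε) (deficit⇒*ℕ≤ℕ r n _ r<1 (deficit-*-cancel 8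
    (deficit-mono (offset≤ n 2qB₀≤n) ≤-refl (f-deficit n (≤-trans (m≤n*m B₀ (2 * q)) 2qB₀≤n)))))
  where
  q : ℕ
  q = ↧ₙ r
  M : ℕ
  M = 8 * q
  -- q = ↧ₙ r is a successor, so suc (pred (M + M)) reduces to M + M.
  open Construction g c M (proj₁ (densityOne⇒deficit c≈g (pred (M + M)))) (proj₂ (densityOne⇒deficit c≈g (pred (M + M))))
  offset≤ : ∀ n → 2 * q * B₀ ≤ n → M * B₀ + 4 * n ≤ 8 * n
  offset≤ n 2qB₀≤n = begin
    M * B₀ + 4 * n           ≡⟨ cong (_+ 4 * n) (eight-q q B₀) ⟩
    4 * (2 * q * B₀) + 4 * n ≤⟨ +-monoˡ-≤ (4 * n) (*-monoʳ-≤ 4 2qB₀≤n) ⟩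
    4 * n + 4 * n            ≡⟨ *-distribʳ-+ n 4 4 ⟨
    8 * n                    ∎
    where
    open ≤-Reasoning
    eight-q : ∀ q B → 8 * q * B ≡ 4 * (2 * q * B)
    eight-q = solve-∀
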